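{- Let $N$ be a homogeneous network with asymmetric inputs, $\tilde{N}$ its fundamental network, and $B$ a backward connected subnetwork of $N$. Then $\tilde{N}$ is a lift of $B$.
   Context: A homogeneous network with asymmetric inputs has a finite cell set $C$, one cell type, $k$ edge types, each cell receiving exactly one edge of each type; it is represented by $\sigma_1,\dots,\sigma_k:C\to C$ (type-$i$ edge into $c$ comes from $\sigma_i(c)$). A subnetwork of $N$ is given by a set of cells $C'\subseteq C$ such that every edge targeting a cell of $C'$ has source in $C'$ (i.e. $\sigma_i(C')\subseteq C'$), together with all edges targeting $C'$; it is represented by $\sigma_i|_{C'}$. A network is backward connected if there is a cell $c$ such that every other cell has a directed path to $c$. $L$ is a lift of $B$ if $B$ is a quotient network of $L$ (obtained by a balanced coloring), equivalently there is a surjective network fibration $L\to B$ (for asymmetric inputs: a surjective cell map commuting with the representing functions). Networks are identified up to isomorphism. The fundamental network $\tilde{N}$ has as cells the semigroup $\tilde{C}$ of maps $C\to C$ generated under composition by $Id_C,\sigma_1,\dots,\sigma_k$, represented by $\tilde{\sigma}_i(\gamma)=\sigma_i\circ\gamma$. -}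

module Defs where

open import Data.Nat using (ℕ)
open import Data.Fin using (Fin)
open import Data.Fin.Subset using (Subset; _∈_)
open import Data.List using (List; []; _∷_)
open import Data.Product using (Σ; ∃; _×_; ∃-syntax)
open import Relation.Binary.PropositionalEquality using (_≡_)

-- A homogeneous network with asymmetric inputs, k edge types, cells Fin n:
-- σ i c is the source of the type-i edge into c.
Network : ℕ → ℕ → Set
Network k n = Fin k → Fin n → Fin n

-- A set of cells C' determines a subnetwork iff it is closed under all σ i.
-- The subnetwork B has cells C' and representing maps σ i restricted to C'.
IsSubnetwork : ∀ {k n} → Network k n → Subset n → Set
IsSubnetwork {k} {n} σ C' = ∀ (i : Fin k) (c : Fin n) → c ∈ C' → σ i c ∈ C'

-- Directed paths inside the subnetwork on C' from d to c.
-- The type-i edge into x has source σ i x, so an edge goes σ i x ⟶ x.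
data PathIn {k n} (σ : Network k n) (C' : Subset n) : Fin n → Fin n → Set where
  here : ∀ {c} → c ∈ C' → PathIn σ C' c c
  step : ∀ (i : Fin k) {x c} → σ i x ∈ C' → PathIn σ C' x c → PathIn σ C' (σ i x) c

BackwardConnectedSub : ∀ {k n} → Network k n → Subset n → Set
BackwardConnectedSub {k} {n} σ C' =
  ∃[ c ] (c ∈ C' × (∀ (d : Fin n) → d ∈ C' → PathIn σ C' d c))

-- Its cells are the maps C → C generated by Id and the σ i
-- under composition.  Every such map is  σ i₁ ∘ ... ∘ σ iₘ  for a word [i₁,...,iₘ]
-- (the empty word giving Id), so we present the cell set as the setoid of words
-- modulo equality of the induced maps (pointwise equality on the finite set C).
FCell : ℕ → Set
FCell k = List (Fin k)

eval : ∀ {k n} → Network k n → FCell k → Fin n → Fin n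
eval σ []      x = x
eval σ (i ∷ w) x = σ i (eval σ w x)

_≈F_ : ∀ {k n} {σ : Network k n} → FCell k → FCell k → Set
_≈F_ {n = n} {σ = σ} w v = ∀ (x : Fin n) → eval σ w x ≡ eval σ v x

fσ : ∀ {k} → Fin k → FCell k → FCell k
fσ i w = i ∷ w

-- The fundamental network of σ is a lift of the subnetwork on C':
-- there is a surjective network fibration (well defined on the cells of Ñ,
-- i.e. respecting ≈F) from Ñ onto the subnetwork on C'.
FundIsLiftOfSub : ∀ {k n} → Network k n → Subset n → Set
FundIsLiftOfSub {k} {n} σ C' =
  Σ (FCell k → Fin n) λ φ →
      (∀ w v → _≈F_ {σ = σ} w v → φ w ≡ φ v)
    × (∀ w → φ w ∈ C')
    × (∀ (i : Fin k) w → φ (fσ i w) ≡ σ i (φ w))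
    × (∀ c → c ∈ C' → ∃[ w ] (φ w ≡ c))

-- Evaluation at the root c of B, γ ↦ γ c, is the fibration: it commutes with the
-- representing maps because σ̃ i γ c = σ i (γ c), it lands in B because B is closed
-- under every σ i, and it is onto B because a path from d to c, read backwards,
-- is a word w with w c = d.
module Submission where

open import Defs
open import Data.Nat using (ℕ)
open import Data.Fin using (Fin)
open import Data.Fin.Subset using (Subset; _∈_)
open import Data.List using ([]; _∷_)
open import Data.Product using (_,_; ∃-syntax)
open import Relation.Binary.PropositionalEquality using (_≡_; refl; cong)

module _ {k n} (σ : Network k n) where

  eval-∈ : ∀ {C'} → IsSubnetwork σ C' → ∀ {c} → c ∈ C' → ∀ w → eval σ w c ∈ C'
  eval-∈ closed c∈C' []      = c∈C'
  eval-∈ closed c∈C' (i ∷ w) = closed i _ (eval-∈ closed c∈C' w)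

  PathIn⇒word : ∀ {C' d c} → PathIn σ C' d c → ∃[ w ] (eval σ w c ≡ d)
  PathIn⇒word (here _)     = [] , refl
  PathIn⇒word (step i _ p) with PathIn⇒word p
  ... | w , w·c≡x = i ∷ w , cong (σ i) w·c≡x

mainTheorem7 : ∀ (k n : ℕ) (σ : Network k n) (C' : Subset n)
    → IsSubnetwork σ C' → BackwardConnectedSub σ C' → FundIsLiftOfSub σ C'
mainTheorem7 k n σ C' closed (c , c∈C' , pathTo-c) =
    evalAt-c
  , (λ w v w≈v → w≈v c)
  , eval-∈ σ closed c∈C'
  , (λ i w → refl)
  , (λ d d∈C' → PathIn⇒word σ (pathTo-c d d∈C'))
  where
  evalAt-c : FCell k → Fin n
  evalAt-c w = eval σ w c
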